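{- Let $L(m,n)=3\frac{m^2+m}{2}+2nm+n^2+n$. Then, as formal power series in $x,q$, \[ \sum_{\pi\in\ell\mathcal{G}_1}x^{\#(\pi)}q^{|\pi|}=\sum_{m,n\ge0}\frac{x^{m+n}q^{L(m,n)}}{(q;q)_m(q^4;q^4)_{\lfloor n/2\rfloor}}+\sum_{m,n\ge0}\frac{x^{m+n+1}q^{L(m,n)+2m+2n+1}}{(q;q)_m(q^4;q^4)_{\lfloor n/2\rfloor}}, \] \[ \sum_{\pi\in\ell\mathcal{G}_2}x^{\#(\pi)}q^{|\pi|}=\sum_{m,n\ge0}\frac{x^{m+n}q^{L(m,n)}}{(q;q)_m(q^4;q^4)_{\lfloor n/2\rfloor}}. \]
   Context: A partition is a finite non-decreasing sequence $\pi=(\lambda_1,\dots,\lambda_{\#(\pi)})$ of positive integers (the empty sequence is the unique partition of $0$); $\#(\pi)$ is its number of parts and $|\pi|$ the sum of its parts. For $i=1,2$, $\ell\mathcal{G}_i$ is the set of partitions all of whose parts are $\ge i$, with $\lambda_j-\lambda_{j-1}\ge2$ for $j\ge2$ and no two consecutive odd parts, i.e. $\lambda_j-\lambda_{j-1}\ge3$ whenever $\lambda_j$ is odd. $(a;q)_k=\prod_{i=0}^{k-1}(1-aq^i)$. -}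

module Defs where

open import Data.Nat using (ℕ; zero; suc; _+_; _*_; _∸_; _≤_; _≤ᵇ_; _/_; _%_)
open import Data.Nat.Divisibility using (_∣?_)
open import Data.Bool using (if_then_else_)
open import Data.List using (List; []; _∷_; map; upTo; length)
open import Data.Nat.ListAction using (sum)
open import Data.List.Relation.Unary.Unique.Propositional using (Unique)
open import Data.List.Membership.Propositional using (_∈_)
open import Data.List.Relation.Unary.All using (All)
open import Data.Product using (_×_; Σ)
open import Relation.Binary.PropositionalEquality using (_≡_)
open import Relation.Nullary using (does)

-- Partitions in ℓG_i.  A partition is a list (λ₁ , … , λₖ) read in
-- non-decreasing order (λ₁ is the smallest part).

Gap : ℕ → ℕ → Set
Gap a b = (2 + a ≤ b) × (b % 2 ≡ 1 → 3 + a ≤ b)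

data Chain : List ℕ → Set where
  []  : Chain []
  [_] : (x : ℕ) → Chain (x ∷ [])
  _∷_ : ∀ {x y ys} → Gap x y → Chain (y ∷ ys) → Chain (x ∷ y ∷ ys)

lG : ℕ → List ℕ → Set
lG i π = All (i ≤_) π × Chain π

-- Formal power series in q with ℕ coefficients (coefficient functions).

Series : Set
Series = ℕ → ℕ

one : Series
one zero    = 1
one (suc _) = 0

_⊛_ : Series → Series → Series
(f ⊛ g) N = sum (map (λ i → f i * g (N ∸ i)) (upTo (suc N)))

-- 1 / (1 - q^a)  (for a ≥ 1) = Σ_k q^{a k}
geo : ℕ → Series
geo a N = if does (a ∣? N) then 1 else 0

-- 1 / (q^d ; q^d)_m = 1 / ∏_{t=1}^{m} (1 - q^{d t})
invQP : ℕ → ℕ → Series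
invQP d zero    = one
invQP d (suc m) = invQP d m ⊛ geo (d * suc m)

shift : ℕ → Series → Series
shift s f N = if s ≤ᵇ N then f (N ∸ s) else 0

L : ℕ → ℕ → ℕ
L m n = 3 * ((m * m + m) / 2) + 2 * n * m + n * n + n

term : ℕ → ℕ → Series
term m n = invQP 1 m ⊛ invQP 4 (n / 2)

-- coefficient of x^k q^N in Σ_{m,n} x^{m+n} q^{L(m,n)} term m n
sumA : ℕ → ℕ → ℕ
sumA k N = sum (map (λ m → shift (L m (k ∸ m)) (term m (k ∸ m)) N) (upTo (suc k)))

-- coefficient of x^k q^N in Σ_{m,n} x^{m+n+1} q^{L(m,n)+2m+2n+1} term m n
sumB : ℕ → ℕ → ℕ
sumB zero    N = 0
sumB (suc k) N =
  sum (map (λ m → shift (L m (k ∸ m) + 2 * m + 2 * (k ∸ m) + 1) (term m (k ∸ m)) N)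
           (upTo (suc k)))

-- "there are exactly c partitions in ℓG_i with k parts and weight N",
-- witnessed by a duplicate-free list enumerating them.
EnumCount : ℕ → ℕ → ℕ → ℕ → Set
EnumCount i k N c =
  Σ (List (List ℕ)) λ Ls → Unique Ls × (∀ π → (π ∈ Ls → lG i π × length π ≡ k × sum π ≡ N)
                                           × (lG i π × length π ≡ k × sum π ≡ N → π ∈ Ls))
                            × length Ls ≡ c

module Submission where

-- Write G_i(k, N) for the number of partitions in ℓG_i with k parts and weight N,
-- and A_k(q), B_k(q) for the x^k-coefficients of the two double sums.  Both sides
-- satisfy the same recursion in (k, N):
--
--   G₂(k+1) = q^{2k+2} G₂(k) + q^{4k+3} G₂(k) + q^{2k+2} G₂(k+1),  G₂(0) = 1,
--   G₁(k+1) = q^{2k+1} G₂(k) + G₂(k+1).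
--
-- Combinatorially, a partition in ℓG₂ with k+1 parts has smallest part 2, 3 or ≥ 4;
-- removing that part and lowering the others by 2 (twice after a 3), resp. lowering
-- all parts by 2, gives a partition in ℓG₂; in ℓG₁ a smallest part 1 is removed likewise.
-- Analytically, A_k = q^{k(k+1)} F_k where F(x) = T(x) V(x) is the product of Euler's
-- series T(x) = Σ q^{m(m+1)/2} x^m/(q;q)_m and V(x) = Σ x^n/(q⁴;q⁴)_{⌊n/2⌋}; the
-- functional equations T(x) = (1+qx) T(qx) and V(x) = (1+x) W(x), W(x) = x²W(x) + W(q²x)
-- give F(x) = x F(x) + (1+qx) F(q²x), whose x^{k+1}-coefficient is the recursion; and
-- B_{k+1} = q^{2k+1} A_k directly.

open import Level using (Level)
open import Algebra using (CommutativeSemiring)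
open import Algebra.Structures using (IsCommutativeMonoid)
open import Algebra.Structures.Biased using (isCommutativeSemiringˡ)
open import Data.Nat using (ℕ; zero; suc; _∸_)
import Data.Nat as Nat
open import Data.Product using (_×_; _,_; Σ; proj₂)
open import Relation.Binary.Bundles using (Setoid)
open import Relation.Binary.Structures using (IsEquivalence)
import Relation.Binary.PropositionalEquality as ≡

-- Formal power series Σ fₙ zⁿ over a commutative semiring R, represented by
-- their coefficient sequences and compared coefficientwise.  They form a
-- commutative semiring again, so the construction can be iterated (series
-- in x whose coefficients are series in q), and the ring solver applies.
module FormalPowerSeries {c ℓ : Level} (R : CommutativeSemiring c ℓ) where

  open CommutativeSemiring R
  open import Relation.Binary.Reasoning.Setoid setoid
  open import Algebra.Solver.Ring.NaturalCoefficients.Default R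
    using (solve; _:=_; _:+_; _:*_; con)

  Seq : Set c
  Seq = ℕ → Carrier

  infix 4 _≋_
  _≋_ : Seq → Seq → Set ℓ
  f ≋ g = ∀ n → f n ≈ g n

  ≋-refl : ∀ {f} → f ≋ f
  ≋-refl n = refl

  ≋-sym : ∀ {f g} → f ≋ g → g ≋ f
  ≋-sym p n = sym (p n)

  ≋-trans : ∀ {f g h} → f ≋ g → g ≋ h → f ≋ h
  ≋-trans p q n = trans (p n) (q n)

  infixl 6 _⊕_
  _⊕_ : Seq → Seq → Seq
  (f ⊕ g) n = f n + g n

  ⊕-cong : ∀ {f f′ g g′} → f ≋ f′ → g ≋ g′ → f ⊕ g ≋ f′ ⊕ g′
  ⊕-cong p q n = +-cong (p n) (q n)

  𝟘 𝟙 : Seq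
  𝟘 n = 0#
  𝟙 zero    = 1#
  𝟙 (suc n) = 0#

  scale : Carrier → Seq → Seq
  scale a f n = a * f n

  X : Seq → Seq
  X f zero    = 0#
  X f (suc n) = f n

  tail : Seq → Seq
  tail f n = f (suc n)

  X-cong : ∀ {f g} → f ≋ g → X f ≋ X g
  X-cong p zero    = refl
  X-cong p (suc n) = p n

  X-⊕ : ∀ f g → X (f ⊕ g) ≋ X f ⊕ X g
  X-⊕ f g zero    = sym (+-identityˡ _)
  X-⊕ f g (suc n) = refl

  split : ∀ f → f ≋ scale (f 0) 𝟙 ⊕ X (tail f)
  split f zero    = sym (trans (+-identityʳ _) (*-identityʳ _))
  split f (suc n) = sym (trans (+-cong (zeroʳ _) refl) (+-identityˡ _))

  infixl 7 _⊛_
  _⊛_ : Seq → Seq → Seq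
  (f ⊛ g) zero    = f 0 * g 0
  (f ⊛ g) (suc n) = f 0 * g (suc n) + (tail f ⊛ g) n

  ⊛-cong : ∀ {f f′ g g′} → f ≋ f′ → g ≋ g′ → f ⊛ g ≋ f′ ⊛ g′
  ⊛-cong p q zero    = *-cong (p 0) (q 0)
  ⊛-cong p q (suc n) = +-cong (*-cong (p 0) (q (suc n))) (⊛-cong (λ m → p (suc m)) q n)

  ⊛-zeroˡ : ∀ g → 𝟘 ⊛ g ≋ 𝟘
  ⊛-zeroˡ g zero    = zeroˡ (g 0)
  ⊛-zeroˡ g (suc n) = trans (+-cong (zeroˡ _) (⊛-zeroˡ g n)) (+-identityˡ 0#)

  ⊛-identityˡ : ∀ g → 𝟙 ⊛ g ≋ g
  ⊛-identityˡ g zero    = *-identityˡ _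
  ⊛-identityˡ g (suc n) = trans (+-cong (*-identityˡ _) (⊛-zeroˡ g n)) (+-identityʳ _)

  ⊛-identityʳ : ∀ f → f ⊛ 𝟙 ≋ f
  ⊛-identityʳ f zero    = *-identityʳ _
  ⊛-identityʳ f (suc n) = trans (+-cong (zeroʳ _) (⊛-identityʳ (tail f) n)) (+-identityˡ _)

  private
    interchange : ∀ a b c d → (a + b) + (c + d) ≈ (a + c) + (b + d)
    interchange = solve 4 (λ a b c d → (a :+ b) :+ (c :+ d) := (a :+ c) :+ (b :+ d)) refl

  ⊛-distribʳ : ∀ f h g → (f ⊕ h) ⊛ g ≋ f ⊛ g ⊕ h ⊛ g
  ⊛-distribʳ f h g zero    = distribʳ (g 0) (f 0) (h 0)
  ⊛-distribʳ f h g (suc n) =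
    trans (+-cong (distribʳ _ _ _) (⊛-distribʳ (tail f) (tail h) g n)) (interchange _ _ _ _)

  ⊛-distribˡ : ∀ f g h → f ⊛ (g ⊕ h) ≋ f ⊛ g ⊕ f ⊛ h
  ⊛-distribˡ f g h zero    = distribˡ _ _ _
  ⊛-distribˡ f g h (suc n) =
    trans (+-cong (distribˡ _ _ _) (⊛-distribˡ (tail f) g h n)) (interchange _ _ _ _)

  ⊛-scaleˡ : ∀ a f g → scale a f ⊛ g ≋ scale a (f ⊛ g)
  ⊛-scaleˡ a f g zero    = *-assoc _ _ _
  ⊛-scaleˡ a f g (suc n) =
    trans (+-cong (*-assoc _ _ _) (⊛-scaleˡ a (tail f) g n)) (sym (distribˡ _ _ _))

  ⊛-scaleʳ : ∀ a f g → f ⊛ scale a g ≋ scale a (f ⊛ g)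
  ⊛-scaleʳ a f g zero    = x[ay]≈a[xy] _ _ _
    where x[ay]≈a[xy] = solve 3 (λ x a y → x :* (a :* y) := a :* (x :* y)) refl
  ⊛-scaleʳ a f g (suc n) =
    trans (+-cong (x[ay]≈a[xy] _ _ _) (⊛-scaleʳ a (tail f) g n)) (sym (distribˡ _ _ _))
    where x[ay]≈a[xy] = solve 3 (λ x a y → x :* (a :* y) := a :* (x :* y)) refl

  ⊛-Xˡ : ∀ f g → X f ⊛ g ≋ X (f ⊛ g)
  ⊛-Xˡ f g zero    = zeroˡ _
  ⊛-Xˡ f g (suc n) = trans (+-cong (zeroˡ _) refl) (+-identityˡ _)

  ⊛-Xʳ : ∀ f g → f ⊛ X g ≋ X (f ⊛ g)
  ⊛-Xʳ f g zero          = zeroʳ _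
  ⊛-Xʳ f g (suc zero)    = trans (+-cong refl (zeroʳ _)) (+-identityʳ _)
  ⊛-Xʳ f g (suc (suc n)) = +-cong refl (⊛-Xʳ (tail f) g (suc n))

  ⊛-splitʳ : ∀ g f → g ⊛ f ≋ scale (f 0) g ⊕ X (g ⊛ tail f)
  ⊛-splitʳ g f =
    ≋-trans (⊛-cong ≋-refl (split f))
      (≋-trans (⊛-distribˡ g _ _)
        (⊕-cong (≋-trans (⊛-scaleʳ (f 0) g 𝟙) (λ n → *-cong refl (⊛-identityʳ g n)))
                (⊛-Xʳ g (tail f))))

  ⊛-comm : ∀ f g → f ⊛ g ≋ g ⊛ f
  ⊛-comm f g zero    = *-comm _ _
  ⊛-comm f g (suc n) = trans (+-cong refl (⊛-comm (tail f) g n)) (sym (⊛-splitʳ g f (suc n)))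

  ⊛-assoc : ∀ f g h → (f ⊛ g) ⊛ h ≋ f ⊛ (g ⊛ h)
  ⊛-assoc f g h zero    = *-assoc _ _ _
  ⊛-assoc f g h (suc n) = begin
      ((f ⊛ g) ⊛ h) (suc n)
    ≈⟨ ⊛-cong split-fg ≋-refl (suc n) ⟩
      ((scale (f 0) g ⊕ X (tail f ⊛ g)) ⊛ h) (suc n)
    ≈⟨ ⊛-distribʳ (scale (f 0) g) (X (tail f ⊛ g)) h (suc n) ⟩
      (scale (f 0) g ⊛ h) (suc n) + (X (tail f ⊛ g) ⊛ h) (suc n)
    ≈⟨ +-cong (⊛-scaleˡ (f 0) g h (suc n))
              (trans (⊛-Xˡ (tail f ⊛ g) h (suc n)) (⊛-assoc (tail f) g h n)) ⟩
      (f ⊛ (g ⊛ h)) (suc n)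
    ∎
    where
      split-fg : f ⊛ g ≋ scale (f 0) g ⊕ X (tail f ⊛ g)
      split-fg zero    = sym (+-identityʳ _)
      split-fg (suc n) = refl

  ≋-isEquivalence : IsEquivalence _≋_
  ≋-isEquivalence = record { refl = ≋-refl ; sym = ≋-sym ; trans = ≋-trans }

  ≋-setoid : Setoid c ℓ
  ≋-setoid = record { isEquivalence = ≋-isEquivalence }

  private
    commutativeMonoid : ∀ {_∙_ ε} → (∀ {f f′ g g′} → f ≋ f′ → g ≋ g′ → (f ∙ g) ≋ (f′ ∙ g′)) →
      (∀ f g h → ((f ∙ g) ∙ h) ≋ (f ∙ (g ∙ h))) → (∀ f → (ε ∙ f) ≋ f) → (∀ f → (f ∙ ε) ≋ f) →
      (∀ f g → (f ∙ g) ≋ (g ∙ f)) → IsCommutativeMonoid _≋_ _∙_ ε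
    commutativeMonoid cong assoc idˡ idʳ comm = record
      { isMonoid = record
        { isSemigroup = record
          { isMagma = record { isEquivalence = ≋-isEquivalence ; ∙-cong = cong }
          ; assoc = assoc }
        ; identity = idˡ , idʳ }
      ; comm = comm }

  seriesSemiring : CommutativeSemiring c ℓ
  seriesSemiring = record
    { isCommutativeSemiring = isCommutativeSemiringˡ record
      { +-isCommutativeMonoid = commutativeMonoid ⊕-cong (λ f g h n → +-assoc _ _ _)
          (λ f n → +-identityˡ _) (λ f n → +-identityʳ _) (λ f g n → +-comm _ _)
      ; *-isCommutativeMonoid = commutativeMonoid ⊛-cong ⊛-assoc ⊛-identityˡ ⊛-identityʳ ⊛-comm
      ; distribʳ = λ g f h → ⊛-distribʳ f h g
      ; zeroˡ = ⊛-zeroˡ } }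

  Xⁿ : ℕ → Seq → Seq
  Xⁿ zero    f = f
  Xⁿ (suc s) f = X (Xⁿ s f)

  Xⁿ-cong : ∀ s {f g} → f ≋ g → Xⁿ s f ≋ Xⁿ s g
  Xⁿ-cong zero    p = p
  Xⁿ-cong (suc s) p = X-cong (Xⁿ-cong s p)

  Xⁿ-+ : ∀ a b f → Xⁿ (a Nat.+ b) f ≡.≡ Xⁿ a (Xⁿ b f)
  Xⁿ-+ zero    b f = ≡.refl
  Xⁿ-+ (suc a) b f = ≡.cong X (Xⁿ-+ a b f)

  Xⁿ-⊕ : ∀ s f g → Xⁿ s (f ⊕ g) ≋ Xⁿ s f ⊕ Xⁿ s g
  Xⁿ-⊕ zero    f g = ≋-refl
  Xⁿ-⊕ (suc s) f g = ≋-trans (X-cong (Xⁿ-⊕ s f g)) (X-⊕ _ _)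

  Xⁿ-𝟘 : ∀ s → Xⁿ s 𝟘 ≋ 𝟘
  Xⁿ-𝟘 zero            = ≋-refl
  Xⁿ-𝟘 (suc s) zero    = refl
  Xⁿ-𝟘 (suc s) (suc n) = Xⁿ-𝟘 s n

  ⊛-Xⁿˡ : ∀ s f g → Xⁿ s f ⊛ g ≋ Xⁿ s (f ⊛ g)
  ⊛-Xⁿˡ zero    f g = ≋-refl
  ⊛-Xⁿˡ (suc s) f g = ≋-trans (⊛-Xˡ (Xⁿ s f) g) (X-cong (⊛-Xⁿˡ s f g))

  ⊛-Xⁿʳ : ∀ s f g → f ⊛ Xⁿ s g ≋ Xⁿ s (f ⊛ g)
  ⊛-Xⁿʳ s f g =
    ≋-trans (⊛-comm f (Xⁿ s g)) (≋-trans (⊛-Xⁿˡ s g f) (Xⁿ-cong s (⊛-comm g f)))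

  𝕫 : Seq
  𝕫 = X 𝟙

  𝕫⊛ : ∀ g → 𝕫 ⊛ g ≋ X g
  𝕫⊛ g = ≋-trans (⊛-Xˡ 𝟙 g) (X-cong (⊛-identityˡ g))

  ∑< : (ℕ → Carrier) → ℕ → Carrier
  ∑< h zero    = 0#
  ∑< h (suc n) = h 0 + ∑< (λ i → h (suc i)) n

  ⊛-as-∑ : ∀ f g n → (f ⊛ g) n ≈ ∑< (λ i → f i * g (n ∸ i)) (suc n)
  ⊛-as-∑ f g zero    = sym (+-identityʳ _)
  ⊛-as-∑ f g (suc n) = +-cong refl (⊛-as-∑ (tail f) g n)

  1+_z : Carrier → Seq
  1+ a z = 𝟙 ⊕ X (scale a 𝟙)

  1+z⊛ : ∀ a f → (1+ a z) ⊛ f ≋ f ⊕ X (scale a f)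
  1+z⊛ a f = ≋-trans (⊛-distribʳ 𝟙 (X (scale a 𝟙)) f)
    (⊕-cong (⊛-identityˡ f)
            (≋-trans (⊛-Xˡ (scale a 𝟙) f)
                     (X-cong (≋-trans (⊛-scaleˡ a 𝟙 f) (λ m → *-cong refl (⊛-identityˡ f m))))))

  1+z-cong : ∀ {a b} → a ≈ b → 1+ a z ≋ 1+ b z
  1+z-cong a≈b = ⊕-cong ≋-refl (X-cong (λ n → *-cong a≈b refl))

  1+1z : 1+ 1# z ≋ 𝟙 ⊕ 𝕫
  1+1z = ⊕-cong ≋-refl (X-cong (λ n → *-identityˡ (𝟙 n)))

  -- the substitution z ↦ x z, i.e. (σ x f)ₙ = xⁿ fₙ; it is a ring homomorphism
  _^_ : Carrier → ℕ → Carrier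
  x ^ zero  = 1#
  x ^ suc n = x * x ^ n

  σ : Carrier → Seq → Seq
  σ x f n = x ^ n * f n

  σ-cong : ∀ x {f g} → f ≋ g → σ x f ≋ σ x g
  σ-cong x p n = *-cong refl (p n)

  σ-⊛ : ∀ x f g → σ x (f ⊛ g) ≋ σ x f ⊛ σ x g
  σ-⊛ x f g zero    = trans (*-identityˡ _) (sym (*-cong (*-identityˡ _) (*-identityˡ _)))
  σ-⊛ x f g (suc n) = begin
      (x * xⁿ) * (f 0 * g (suc n) + (tail f ⊛ g) n)
    ≈⟨ solve 5 (λ x p a b h → (x :* p) :* (a :* b :+ h) := a :* (x :* p :* b) :+ x :* (p :* h))
             refl x xⁿ (f 0) (g (suc n)) ((tail f ⊛ g) n) ⟩
      f 0 * ((x * xⁿ) * g (suc n)) + x * (xⁿ * (tail f ⊛ g) n)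
    ≈⟨ +-cong (*-cong (sym (*-identityˡ _)) refl) (*-cong refl (σ-⊛ x (tail f) g n)) ⟩
      (1# * f 0) * ((x * xⁿ) * g (suc n)) + x * (σ x (tail f) ⊛ σ x g) n
    ≈⟨ +-cong refl (sym (trans (⊛-cong tail-σ ≋-refl n) (⊛-scaleˡ x (σ x (tail f)) (σ x g) n))) ⟩
      (1# * f 0) * ((x * xⁿ) * g (suc n)) + (tail (σ x f) ⊛ σ x g) n
    ∎
    where
      xⁿ = x ^ n
      tail-σ : tail (σ x f) ≋ scale x (σ x (tail f))
      tail-σ m = *-assoc _ _ _

  σ-1+z : ∀ x a → σ x (1+ a z) ≋ 1+ (x * a) z
  σ-1+z x a zero          = trans (*-identityˡ _) refl
  σ-1+z x a (suc zero)    =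
    solve 2 (λ x a → (x :* con 1) :* (con 0 :+ a :* con 1) := con 0 :+ (x :* a) :* con 1) refl x a
  σ-1+z x a (suc (suc n)) = trans (zeroʳ′ (x ^ suc (suc n))) (sym (trans (+-identityˡ _) (zeroʳ _)))
    where
      zeroʳ′ : ∀ y → y * (0# + a * 0#) ≈ 0#
      zeroʳ′ y = trans (*-cong refl (trans (+-identityˡ _) (zeroʳ _))) (zeroʳ _)

  ^-distrib-* : ∀ x y n → x ^ n * y ^ n ≈ (x * y) ^ n
  ^-distrib-* x y zero    = *-identityˡ _
  ^-distrib-* x y (suc n) =
    trans (solve 4 (λ x a y b → (x :* a) :* (y :* b) := (x :* y) :* (a :* b)) refl x (x ^ n) y (y ^ n))
          (*-cong refl (^-distrib-* x y n))

  σ-σ : ∀ x y f → σ x (σ y f) ≋ σ (x * y) f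
  σ-σ x y f n = trans (sym (*-assoc _ _ _)) (*-cong (^-distrib-* x y n) refl)

open import Defs
open import Data.Nat using (_+_; _*_; _≤_; _<_; _≤ᵇ_; s≤s; z≤n; _/_; _%_)
import Data.Nat.Properties as ℕ
open import Data.Nat.Divisibility using (_∣?_; ∣⇒≤; ∣-refl; _∣0; ∣m∣n⇒∣m+n; ∣m+n∣m⇒∣n)
open import Data.Nat.DivMod using (m/n≡1+[m∸n]/n; m*n/n≡m; [m+n]%n≡m%n)
open import Data.Nat.Solver using (module +-*-Solver)
open import Data.Nat.ListAction using (sum)
open import Data.Bool using (true; false; if_then_else_)
import Data.Bool as Bool
open import Data.Unit using (tt)
open import Data.Sum using (_⊎_; inj₁; inj₂)
open import Data.List using (List; []; _∷_; map; length; _++_; applyUpTo)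
open import Data.List.Properties using (length-map; length-++; map-injective; ∷-injective)
open import Data.List.Relation.Unary.All as All using (All; []; _∷_)
open import Data.List.Relation.Unary.Any using (here)
open import Data.List.Relation.Unary.AllPairs using ([]; _∷_)
open import Data.List.Relation.Unary.Unique.Propositional using (Unique)
import Data.List.Relation.Unary.Unique.Propositional.Properties as UP
open import Data.List.Relation.Binary.Disjoint.Propositional using (Disjoint)
open import Data.List.Membership.Propositional using (_∈_)
open import Data.List.Membership.Propositional.Properties using (∈-map⁺; ∈-map⁻; ∈-++⁺ˡ; ∈-++⁺ʳ; ∈-++⁻)
open import Function using (_∘_)
open import Function.Bundles using (mk⇔)
open import Relation.Nullary.Decidable using (dec-true; dec-false; does-⇔)
open ≡ using (_≡_; refl; sym; trans; cong; cong₂; subst; module ≡-Reasoning)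

-- Q: power series in q with coefficients in ℕ (the type 'Series' of Defs);
-- XQ: power series in x whose coefficients are such series.
module Q  = FormalPowerSeries ℕ.+-*-commutativeSemiring
module XQ = FormalPowerSeries Q.seriesSemiring

open Q using (_≋_; _⊕_; 𝟙; Xⁿ; ≋-refl; ≋-sym; ≋-trans)

≡⇒≋ : ∀ {f g : Series} → f ≡ g → f ≋ g
≡⇒≋ refl = ≋-refl

sum-applyUpTo : ∀ (h : ℕ → ℕ) g n → sum (map h (applyUpTo g n)) ≡ Q.∑< (h ∘ g) n
sum-applyUpTo h g zero    = refl
sum-applyUpTo h g (suc n) = cong (h (g 0) +_) (sum-applyUpTo h (g ∘ suc) n)

Defs⊛≋⊛ : ∀ f g → f ⊛ g ≋ f Q.⊛ g
Defs⊛≋⊛ f g N = trans (sum-applyUpTo _ (λ i → i) (suc N)) (sym (Q.⊛-as-∑ f g N))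

shift≡Xⁿ : ∀ s f N → shift s f N ≡ Xⁿ s f N
shift≡Xⁿ zero          f N       = refl
shift≡Xⁿ (suc s)       f zero    = refl
shift≡Xⁿ (suc zero)    f (suc N) = refl
shift≡Xⁿ (suc (suc s)) f (suc N) = shift≡Xⁿ (suc s) f N

one≋𝟙 : one ≋ 𝟙
one≋𝟙 zero    = refl
one≋𝟙 (suc N) = refl

Xⁿ-at : ∀ s f M → Xⁿ s f (s + M) ≡ f M
Xⁿ-at zero    f M = refl
Xⁿ-at (suc s) f M = Xⁿ-at s f M

Xⁿ-below : ∀ s f N → N < s → Xⁿ s f N ≡ 0
Xⁿ-below (suc s) f zero    _         = refl
Xⁿ-below (suc s) f (suc N) (s≤s N<s) = Xⁿ-below s f N N<s

Xⁿ-split : ∀ s (f g : Series) N → (∀ M → f (s + M) ≡ g (s + M)) → (N < s → f N ≡ g N) → f N ≡ g N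
Xⁿ-split s f g N above below with ℕ.≤-<-connex s N
... | inj₁ s≤N = subst (λ n → f n ≡ g n) (ℕ.m+[n∸m]≡n s≤N) (above (N ∸ s))
... | inj₂ N<s = below N<s

geo-eq : ∀ a → geo (suc a) ≋ 𝟙 ⊕ Xⁿ (suc a) (geo (suc a))
geo-eq a N = Xⁿ-split (suc a) (geo (suc a)) (𝟙 ⊕ Xⁿ (suc a) (geo (suc a))) N above below
  where
    indicator = λ b → if b then 1 else 0
    periodic : ∀ M → geo (suc a) (suc a + M) ≡ geo (suc a) M
    periodic M = cong indicator
      (does-⇔ (mk⇔ (λ d → ∣m+n∣m⇒∣n d ∣-refl) (∣m∣n⇒∣m+n ∣-refl)) (suc a ∣? (suc a + M)) (suc a ∣? M))
    above : ∀ M → geo (suc a) (suc a + M) ≡ Xⁿ (suc a) (geo (suc a)) (suc a + M)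
    above M = trans (periodic M) (sym (Xⁿ-at (suc a) (geo (suc a)) M))
    below : N < suc a → geo (suc a) N ≡ 𝟙 N + Xⁿ (suc a) (geo (suc a)) N
    below N<s rewrite Xⁿ-below (suc a) (geo (suc a)) N N<s | ℕ.+-identityʳ (𝟙 N) = small N N<s
      where
        small : ∀ N → N < suc a → geo (suc a) N ≡ 𝟙 N
        small zero    _       = cong indicator (dec-true (suc a ∣? 0) (suc a ∣0))
        small (suc N) (s≤s N<a) =
          cong indicator (dec-false (suc a ∣? suc N) (λ d → ℕ.<⇒≱ N<a (ℕ.≤-pred (∣⇒≤ d))))

invQP-eq : ∀ d m → invQP (suc d) (suc m) ≋ invQP (suc d) m ⊕ Xⁿ (suc d * suc m) (invQP (suc d) (suc m))
invQP-eq d m = begin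
    A ⊛ G                    ≈⟨ Defs⊛≋⊛ A G ⟩
    A Q.⊛ G                  ≈⟨ Q.⊛-cong {f = A} ≋-refl (geo-eq (m + d * suc m)) ⟩
    A Q.⊛ (𝟙 ⊕ Xⁿ s G)       ≈⟨ Q.⊛-distribˡ A 𝟙 (Xⁿ s G) ⟩
    A Q.⊛ 𝟙 ⊕ A Q.⊛ Xⁿ s G   ≈⟨ Q.⊕-cong (Q.⊛-identityʳ A) (Q.⊛-Xⁿʳ s A G) ⟩
    A ⊕ Xⁿ s (A Q.⊛ G)       ≈⟨ Q.⊕-cong {f = A} ≋-refl (Q.Xⁿ-cong s (≋-sym (Defs⊛≋⊛ A G))) ⟩
    A ⊕ Xⁿ s (A ⊛ G)         ∎
  where
    open import Relation.Binary.Reasoning.Setoid (Q.≋-setoid)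
    A = invQP (suc d) m
    s = suc d * suc m
    G = geo s

Xⁿ-comm : ∀ a b f → Xⁿ a (Xⁿ b f) ≡ Xⁿ b (Xⁿ a f)
Xⁿ-comm a b f = trans (sym (Q.Xⁿ-+ a b f)) (trans (cong (λ e → Xⁿ e f) (ℕ.+-comm a b)) (Q.Xⁿ-+ b a f))

q q² : Series
q  = Q.𝕫
q² = q Q.⊛ q

qⁿ≋ : ∀ n → q XQ.^ n ≋ Xⁿ n 𝟙
qⁿ≋ zero    = ≋-refl
qⁿ≋ (suc n) = ≋-trans (Q.⊛-cong {f = q} ≋-refl (qⁿ≋ n)) (Q.𝕫⊛ (Xⁿ n 𝟙))

σ-q : ∀ F n → XQ.σ q F n ≋ Xⁿ n (F n)
σ-q F n = ≋-trans (Q.⊛-cong (qⁿ≋ n) ≋-refl)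
                  (≋-trans (Q.⊛-Xⁿˡ n 𝟙 (F n)) (Q.Xⁿ-cong n (Q.⊛-identityˡ (F n))))

σ-q² : ∀ F n → XQ.σ q² F n ≋ Xⁿ n (Xⁿ n (F n))
σ-q² F n = ≋-trans (≋-sym (XQ.σ-σ q q F n)) (≋-trans (σ-q (XQ.σ q F) n) (Q.Xⁿ-cong n (σ-q F n)))

-- Euler's series  T(x) = Σₘ q^{m(m+1)/2} xᵐ / (q;q)ₘ = ∏_{i≥1} (1 + x qⁱ),
-- characterised by  T(x) = (1 + qx) T(qx).
tri : ℕ → ℕ
tri zero    = 0
tri (suc m) = tri m + suc m

T : XQ.Seq
T m = Xⁿ (tri m) (invQP 1 m)

T-rec : ∀ m → T (suc m) ≋ Xⁿ (suc m) (T (suc m)) ⊕ Xⁿ (suc m) (T m)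
T-rec m = begin
    Xⁿ t′ (invQP 1 (suc m))
  ≈⟨ Q.Xⁿ-cong t′ (invQP-eq 0 m) ⟩
    Xⁿ t′ (invQP 1 m ⊕ Xⁿ (suc m + 0) (invQP 1 (suc m)))
  ≈⟨ Q.Xⁿ-⊕ t′ _ _ ⟩
    Xⁿ t′ (invQP 1 m) ⊕ Xⁿ t′ (Xⁿ (suc m + 0) (invQP 1 (suc m)))
  ≈⟨ (λ N → ℕ.+-comm (Xⁿ t′ (invQP 1 m) N) _) ⟩
    Xⁿ t′ (Xⁿ (suc m + 0) (invQP 1 (suc m))) ⊕ Xⁿ t′ (invQP 1 m)
  ≡⟨ cong₂ _⊕_ first second ⟩
    Xⁿ (suc m) (T (suc m)) ⊕ Xⁿ (suc m) (T m)
  ∎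
  where
    open import Relation.Binary.Reasoning.Setoid (Q.≋-setoid)
    t′ = tri m + suc m
    first : Xⁿ t′ (Xⁿ (suc m + 0) (invQP 1 (suc m))) ≡ Xⁿ (suc m) (T (suc m))
    first = trans (cong (λ e → Xⁿ t′ (Xⁿ e (invQP 1 (suc m)))) (ℕ.+-identityʳ (suc m)))
                  (Xⁿ-comm t′ (suc m) _)
    second : Xⁿ t′ (invQP 1 m) ≡ Xⁿ (suc m) (T m)
    second = trans (cong (λ e → Xⁿ e (invQP 1 m)) (ℕ.+-comm (tri m) (suc m))) (Q.Xⁿ-+ (suc m) (tri m) _)

T-eq : T XQ.≋ (XQ.1+ q z) XQ.⊛ XQ.σ q T
T-eq m = ≋-sym (≋-trans (XQ.1+z⊛ q (XQ.σ q T) m) (coefficient m))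
  where
    coefficient : ∀ m → (XQ.σ q T XQ.⊕ XQ.X (XQ.scale q (XQ.σ q T))) m ≋ T m
    coefficient zero    N = trans (ℕ.+-identityʳ _) (σ-q T 0 N)
    coefficient (suc m) N = trans
      (cong₂ _+_ (σ-q T (suc m) N) (trans (Q.⊛-cong {f = q} ≋-refl (σ-q T m) N) (Q.𝕫⊛ _ N)))
      (sym (T-rec m N))

-- For a sequence u: the coefficients of u(x²), and the sequence n ↦ u ⌊n/2⌋,
-- which is the coefficient sequence of (1 + x) u(x²).
spread : (ℕ → Series) → ℕ → Series
spread u zero          = u 0
spread u (suc zero)    = Q.𝟘
spread u (suc (suc n)) = spread (u ∘ suc) n

pairUp : (ℕ → Series) → ℕ → Series
pairUp u zero          = u 0
pairUp u (suc zero)    = u 0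
pairUp u (suc (suc n)) = pairUp (u ∘ suc) n

pairUp-/2 : ∀ u n → pairUp u n ≡ u (n / 2)
pairUp-/2 u zero          = refl
pairUp-/2 u (suc zero)    = refl
pairUp-/2 u (suc (suc n)) =
  trans (pairUp-/2 (u ∘ suc) n) (cong u (sym (m/n≡1+[m∸n]/n {suc (suc n)} {2} (s≤s (s≤s z≤n)))))

pairUp≋spread : ∀ u → pairUp u XQ.≋ spread u XQ.⊕ XQ.X (spread u)
pairUp≋spread u zero                N = sym (ℕ.+-identityʳ _)
pairUp≋spread u (suc zero)          N = refl
pairUp≋spread u (suc (suc zero))    N = sym (ℕ.+-identityʳ _)
pairUp≋spread u (suc (suc (suc n))) = pairUp≋spread (u ∘ suc) (suc n)

-- doubling, by a recursion matching that of spread and pairUp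
double : ℕ → ℕ
double zero    = 0
double (suc j) = suc (suc (double j))

data Parity : ℕ → Set where
  even : ∀ j → Parity (double j)
  odd  : ∀ j → Parity (suc (double j))

parity : ∀ n → Parity n
parity zero = even 0
parity (suc n) with parity n
... | even j = odd j
... | odd  j = even (suc j)

spread-even : ∀ u j → spread u (double j) ≡ u j
spread-even u zero    = refl
spread-even u (suc j) = spread-even (u ∘ suc) j

spread-odd : ∀ u j → spread u (suc (double j)) ≡ Q.𝟘
spread-odd u zero    = refl
spread-odd u (suc j) = spread-odd (u ∘ suc) j

double≡j+j : ∀ j → double j ≡ j + j
double≡j+j zero    = refl
double≡j+j (suc j) = cong suc (trans (cong suc (double≡j+j j)) (sym (ℕ.+-suc j j)))

double+double : ∀ j → double j + double j ≡ 4 * j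
double+double j = trans (cong₂ _+_ (double≡j+j j) (double≡j+j j))
                        (solve 1 (λ j → (j :+ j) :+ (j :+ j) := con 4 :* j) refl j)
  where open +-*-Solver

-- W(x) = Σⱼ x²ʲ/(q⁴;q⁴)ⱼ satisfies W(x) = x² W(x) + W(q²x), coefficientwise
-- 1/(q⁴;q⁴)ⱼ₊₁ = 1/(q⁴;q⁴)ⱼ + q^{4(j+1)}/(q⁴;q⁴)ⱼ₊₁.
W : XQ.Seq
W = spread (invQP 4)

W-eq : W XQ.≋ XQ.X (XQ.X W) XQ.⊕ XQ.σ q² W
W-eq n N = trans (coefficient n (parity n) N) (cong (XQ.X (XQ.X W) n N +_) (sym (σ-q² W n N)))
  where
    zero-at : ∀ s → Xⁿ s (Xⁿ s Q.𝟘) ≋ Q.𝟘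
    zero-at s = ≋-trans (Q.Xⁿ-cong s (Q.Xⁿ-𝟘 s)) (Q.Xⁿ-𝟘 s)
    coefficient : ∀ m → Parity m → W m ≋ XQ.X (XQ.X W) m ⊕ Xⁿ m (Xⁿ m (W m))
    coefficient _ (even zero)    N = refl
    coefficient _ (even (suc j)) N = begin
        W (double (suc j)) N
      ≡⟨ cong (λ f → f N) (spread-even (invQP 4) (suc j)) ⟩
        invQP 4 (suc j) N
      ≡⟨ invQP-eq 3 j N ⟩
        invQP 4 j N + Xⁿ (4 * suc j) (invQP 4 (suc j)) N
      ≡⟨ cong₂ (λ f g → f N + Xⁿ (4 * suc j) g N)
               (sym (spread-even (invQP 4) j)) (sym (spread-even (invQP 4) (suc j))) ⟩
        W (double j) N + Xⁿ (4 * suc j) (W m) N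
      ≡⟨ cong (λ e → W (double j) N + Xⁿ e (W m) N) (sym (double+double (suc j))) ⟩
        W (double j) N + Xⁿ (m + m) (W m) N
      ≡⟨ cong (λ f → W (double j) N + f N) (Q.Xⁿ-+ m m (W m)) ⟩
        W (double j) N + Xⁿ m (Xⁿ m (W m)) N
      ∎
      where open ≡-Reasoning
            m = double (suc j)
    coefficient _ (odd zero)     N = sym (zero-at 1 N)
    coefficient _ (odd (suc j))  N =
      trans (cong (λ f → f N) (spread-odd (invQP 4) (suc j)))
            (sym (cong₂ _+_ (cong (λ f → f N) (spread-odd (invQP 4) j))
                            (trans (cong (λ f → Xⁿ m (Xⁿ m f) N) (spread-odd (invQP 4) (suc j))) (zero-at m N))))
      where m = suc (double (suc j))

V : XQ.Seq
V = pairUp (invQP 4)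

V-eq : V XQ.≋ XQ.1+ Q.𝟙 z XQ.⊛ W
V-eq = XQ.≋-trans (pairUp≋spread (invQP 4))
         (XQ.≋-sym (XQ.≋-trans (XQ.1+z⊛ Q.𝟙 W)
                               (XQ.⊕-cong XQ.≋-refl (XQ.X-cong (λ n → Q.⊛-identityˡ (W n))))))

T-eq₂ : T XQ.≋ XQ.1+ q z XQ.⊛ (XQ.1+ q² z XQ.⊛ XQ.σ q² T)
T-eq₂ = XQ.≋-trans T-eq (XQ.⊛-cong {f = XQ.1+ q z} XQ.≋-refl
          (XQ.≋-trans (XQ.σ-cong q T-eq) (XQ.≋-trans (XQ.σ-⊛ q (XQ.1+ q z) (XQ.σ q T))
            (XQ.⊛-cong (XQ.σ-1+z q q) (XQ.σ-σ q q T)))))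

F : XQ.Seq
F = T XQ.⊛ V

σF-eq : XQ.σ q² F XQ.≋ XQ.σ q² T XQ.⊛ (XQ.1+ q² z XQ.⊛ XQ.σ q² W)
σF-eq = XQ.≋-trans (XQ.σ-⊛ q² T V) (XQ.⊛-cong {f = XQ.σ q² T} XQ.≋-refl
          (XQ.≋-trans (XQ.σ-cong q² V-eq) (XQ.≋-trans (XQ.σ-⊛ q² (XQ.1+ Q.𝟙 z) W)
            (XQ.⊛-cong (XQ.≋-trans (XQ.σ-1+z q² Q.𝟙) (XQ.1+z-cong (Q.⊛-identityʳ q²))) XQ.≋-refl))))

-- The functional equation  F(x) = x F(x) + (1 + qx) F(q²x):  with S = T(q²x) and
-- Y = W(q²x), expand F = T W + x T W, rewrite the first W by W-eq and T Y by T-eq₂,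
-- and regroup.
F-eq : F XQ.≋ XQ.X F XQ.⊕ XQ.1+ q z XQ.⊛ XQ.σ q² F
F-eq = begin
    T ⊠ V
  ≈⟨ *-cong (XQ.≋-refl {T}) V≈[1+Z]W ⟩
    T ⊠ ((𝟏 ⊞ Z) ⊠ W)
  ≈⟨ solve 3 (λ t z w → t :* ((con 1 :+ z) :* w) := t :* w :+ z :* (t :* w)) XQ.≋-refl T Z W ⟩
    T ⊠ W ⊞ Z ⊠ (T ⊠ W)
  ≈⟨ +-cong (*-cong (XQ.≋-refl {T}) W≈Z²W+Y) (XQ.≋-refl {Z ⊠ (T ⊠ W)}) ⟩
    T ⊠ (Z ⊠ (Z ⊠ W) ⊞ Y) ⊞ Z ⊠ (T ⊠ W)
  ≈⟨ solve 4 (λ t z w y → t :* (z :* (z :* w) :+ y) :+ z :* (t :* w)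
                         := z :* (z :* (t :* w)) :+ t :* y :+ z :* (t :* w)) XQ.≋-refl T Z W Y ⟩
    Z ⊠ (Z ⊠ (T ⊠ W)) ⊞ T ⊠ Y ⊞ Z ⊠ (T ⊠ W)
  ≈⟨ +-cong (+-cong (XQ.≋-refl {Z ⊠ (Z ⊠ (T ⊠ W))}) (*-cong T-eq₂ (XQ.≋-refl {Y}))) (XQ.≋-refl {Z ⊠ (T ⊠ W)}) ⟩
    Z ⊠ (Z ⊠ (T ⊠ W)) ⊞ P₁ ⊠ (P₂ ⊠ S) ⊠ Y ⊞ Z ⊠ (T ⊠ W)
  ≈⟨ solve 7 (λ t z w y a b s → z :* (z :* (t :* w)) :+ (a :* (b :* s)) :* y :+ z :* (t :* w)
                               := z :* (t :* ((con 1 :+ z) :* w)) :+ a :* (s :* (b :* y)))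
             XQ.≋-refl T Z W Y P₁ P₂ S ⟩
    Z ⊠ (T ⊠ ((𝟏 ⊞ Z) ⊠ W)) ⊞ P₁ ⊠ (S ⊠ (P₂ ⊠ Y))
  ≈⟨ XQ.≋-sym (+-cong (XQ.≋-trans (XQ.≋-sym (XQ.𝕫⊛ F)) (*-cong (XQ.≋-refl {Z}) (*-cong (XQ.≋-refl {T}) V≈[1+Z]W)))
                      (*-cong (XQ.≋-refl {P₁}) σF-eq)) ⟩
    XQ.X F ⊞ P₁ ⊠ XQ.σ q² F
  ∎
  where
    open CommutativeSemiring XQ.seriesSemiring
      using (+-cong; *-cong)
      renaming (_+_ to _⊞_; _*_ to _⊠_; 1# to 𝟏)
    open import Relation.Binary.Reasoning.Setoid XQ.≋-setoid
    open import Algebra.Solver.Ring.NaturalCoefficients.Default XQ.seriesSemiring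
      using (solve; _:=_; _:+_; _:*_; con)
    Z P₁ P₂ S Y : XQ.Seq
    Z  = XQ.𝕫
    P₁ = XQ.1+ q z
    P₂ = XQ.1+ q² z
    S  = XQ.σ q² T
    Y  = XQ.σ q² W
    V≈[1+Z]W : V XQ.≋ (𝟏 ⊞ Z) ⊠ W
    V≈[1+Z]W = XQ.≋-trans V-eq (XQ.⊛-cong XQ.1+1z XQ.≋-refl)
    W≈Z²W+Y : W XQ.≋ Z ⊠ (Z ⊠ W) ⊞ Y
    W≈Z²W+Y = XQ.≋-trans W-eq (XQ.⊕-cong Z²W XQ.≋-refl)
      where Z²W = XQ.≋-sym (XQ.≋-trans (XQ.⊛-cong {f = Z} XQ.≋-refl (XQ.𝕫⊛ W)) (XQ.𝕫⊛ (XQ.X W)))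

F-rec : ∀ K → F (suc K) ≋ F K ⊕ Xⁿ (suc K) (Xⁿ (suc K) (F (suc K))) ⊕ Xⁿ (suc (K + K)) (F K)
F-rec K = ≋-trans (F-eq (suc K))
  (≋-trans (Q.⊕-cong {f = F K} ≋-refl (XQ.1+z⊛ q (XQ.σ q² F) (suc K)))
    (≋-trans (λ N → sym (ℕ.+-assoc (F K N) _ _))
      (Q.⊕-cong (Q.⊕-cong {f = F K} ≋-refl (σ-q² F (suc K)))
                (≋-trans (Q.⊛-cong {f = q} ≋-refl (σ-q² F K))
                  (≋-trans (Q.𝕫⊛ _) (Q.X-cong (≡⇒≋ (sym (Q.Xⁿ-+ K K (F K))))))))))

Xⁿ-∑ : ∀ s h n → Xⁿ s (XQ.∑< h n) ≋ XQ.∑< (λ i → Xⁿ s (h i)) n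
Xⁿ-∑ s h zero    = Q.Xⁿ-𝟘 s
Xⁿ-∑ s h (suc n) = ≋-trans (Q.Xⁿ-⊕ s (h 0) _) (Q.⊕-cong ≋-refl (Xⁿ-∑ s (h ∘ suc) n))

∑-cong : ∀ h h′ n → (∀ i → i < n → h i ≋ h′ i) → XQ.∑< h n ≋ XQ.∑< h′ n
∑-cong h h′ zero    p = ≋-refl
∑-cong h h′ (suc n) p = Q.⊕-cong (p 0 (s≤s z≤n)) (∑-cong (h ∘ suc) (h′ ∘ suc) n (λ i i<n → p (suc i) (s≤s i<n)))

sum-shifts : ∀ (s : ℕ → ℕ) (f : ℕ → Series) g n N →
             sum (map (λ m → shift (s m) (f m) N) (applyUpTo g n)) ≡ XQ.∑< (λ m → Xⁿ (s (g m)) (f (g m))) n N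
sum-shifts s f g zero    N = refl
sum-shifts s f g (suc n) N = cong₂ _+_ (shift≡Xⁿ (s (g 0)) (f (g 0)) N) (sum-shifts s f (g ∘ suc) n N)

-- The exponent L(m,n) splits as  e(m+n) + m(m+1)/2  with  e(K) = K(K+1).
e : ℕ → ℕ
e K = K * suc K

-- 2 · m(m+1)/2 = m² + m, so that (m² + m)/2 in L is tri m.
tri*2 : ∀ i → tri i * 2 ≡ i * i + i
tri*2 zero    = refl
tri*2 (suc i) = begin
    (tri i + suc i) * 2       ≡⟨ ℕ.*-distribʳ-+ 2 (tri i) (suc i) ⟩
    tri i * 2 + suc i * 2     ≡⟨ cong (_+ suc i * 2) (tri*2 i) ⟩
    i * i + i + suc i * 2     ≡⟨ solve 1 (λ i → i :* i :+ i :+ (con 1 :+ i) :* con 2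
                                             := (con 1 :+ i) :* (con 1 :+ i) :+ (con 1 :+ i)) refl i ⟩
    suc i * suc i + suc i     ∎
  where open ≡-Reasoning
        open +-*-Solver

L-eq : ∀ i n → L i n ≡ e (i + n) + tri i
L-eq i n = begin
    3 * ((i * i + i) / 2) + 2 * n * i + n * n + n
  ≡⟨ cong (λ t → 3 * (t / 2) + 2 * n * i + n * n + n) (sym (tri*2 i)) ⟩
    3 * ((t * 2) / 2) + 2 * n * i + n * n + n
  ≡⟨ cong (λ t → 3 * t + 2 * n * i + n * n + n) (m*n/n≡m t 2) ⟩
    3 * t + 2 * n * i + n * n + n
  ≡⟨ solve 3 (λ t n i → con 3 :* t :+ con 2 :* n :* i :+ n :* n :+ n
                       := t :* con 2 :+ (t :+ con 2 :* n :* i :+ n :* n :+ n)) refl t n i ⟩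
    t * 2 + (t + 2 * n * i + n * n + n)
  ≡⟨ cong (_+ (t + 2 * n * i + n * n + n)) (tri*2 i) ⟩
    i * i + i + (t + 2 * n * i + n * n + n)
  ≡⟨ solve 3 (λ t n i → i :* i :+ i :+ (t :+ con 2 :* n :* i :+ n :* n :+ n)
                       := (i :+ n) :* (con 1 :+ (i :+ n)) :+ t) refl t n i ⟩
    e (i + n) + t
  ∎
  where open ≡-Reasoning
        open +-*-Solver
        t = tri i

term≋T⊛V : ∀ K m n → Xⁿ (e K + tri m) (term m n) ≋ Xⁿ (e K) (T m Q.⊛ V n)
term≋T⊛V K m n rewrite Q.Xⁿ-+ (e K) (tri m) (term m n) = Q.Xⁿ-cong (e K) (begin
    Xⁿ (tri m) (invQP 1 m ⊛ invQP 4 (n / 2))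
  ≈⟨ Q.Xⁿ-cong (tri m) (Defs⊛≋⊛ (invQP 1 m) (invQP 4 (n / 2))) ⟩
    Xⁿ (tri m) (invQP 1 m Q.⊛ invQP 4 (n / 2))
  ≡⟨ cong (λ g → Xⁿ (tri m) (invQP 1 m Q.⊛ g)) (sym (pairUp-/2 (invQP 4) n)) ⟩
    Xⁿ (tri m) (invQP 1 m Q.⊛ V n)
  ≈⟨ ≋-sym (Q.⊛-Xⁿˡ (tri m) (invQP 1 m) (V n)) ⟩
    T m Q.⊛ V n
  ∎)
  where open import Relation.Binary.Reasoning.Setoid (Q.≋-setoid)

sumA≋F : ∀ K → sumA K ≋ Xⁿ (e K) (F K)
sumA≋F K = begin
    sumA K
  ≈⟨ sum-shifts (λ m → L m (K ∸ m)) (λ m → term m (K ∸ m)) (λ i → i) (suc K) ⟩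
    XQ.∑< (λ m → Xⁿ (L m (K ∸ m)) (term m (K ∸ m))) (suc K)
  ≈⟨ ∑-cong _ _ (suc K) summand ⟩
    XQ.∑< (λ m → Xⁿ (e K) (T m Q.⊛ V (K ∸ m))) (suc K)
  ≈⟨ ≋-sym (Xⁿ-∑ (e K) (λ m → T m Q.⊛ V (K ∸ m)) (suc K)) ⟩
    Xⁿ (e K) (XQ.∑< (λ m → T m Q.⊛ V (K ∸ m)) (suc K))
  ≈⟨ Q.Xⁿ-cong (e K) (≋-sym (XQ.⊛-as-∑ T V K)) ⟩
    Xⁿ (e K) (F K)
  ∎
  where
    open import Relation.Binary.Reasoning.Setoid (Q.≋-setoid)
    summand : ∀ m → m < suc K → Xⁿ (L m (K ∸ m)) (term m (K ∸ m)) ≋ Xⁿ (e K) (T m Q.⊛ V (K ∸ m))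
    summand m (s≤s m≤K) rewrite L-eq m (K ∸ m) | ℕ.m+[n∸m]≡n m≤K = term≋T⊛V K m (K ∸ m)

w₁ w₂ w₃ : ℕ → ℕ
w₁ k = suc (k + k)
w₂ k = suc k + suc k
w₃ k = w₂ k + w₁ k

Xⁿ-merge : ∀ {a b c d} f → a + b ≡ c + d → Xⁿ a (Xⁿ b f) ≡ Xⁿ c (Xⁿ d f)
Xⁿ-merge {a} {b} {c} {d} f eq =
  trans (sym (Q.Xⁿ-+ a b f)) (trans (cong (λ s → Xⁿ s f) eq) (Q.Xⁿ-+ c d f))

-- The recursion for the first double sum A_k(q):
--   A_{k+1} = q^{2k+2} A_k + q^{4k+3} A_k + q^{2k+2} A_{k+1},
-- the x^{k+1}-coefficient of F-rec times q^{e(k+1)}, as e(k+1) = e(k) + 2k+2.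
sumA-rec : ∀ K → sumA (suc K) ≋ Xⁿ (w₂ K) (sumA K) ⊕ Xⁿ (w₃ K) (sumA K) ⊕ Xⁿ (w₂ K) (sumA (suc K))
sumA-rec K = begin
    sumA (suc K)
  ≈⟨ sumA≋F (suc K) ⟩
    Xⁿ e′ (F (suc K))
  ≈⟨ Q.Xⁿ-cong e′ (F-rec K) ⟩
    Xⁿ e′ (F K ⊕ Xⁿ (suc K) (Xⁿ (suc K) (F (suc K))) ⊕ Xⁿ (w₁ K) (F K))
  ≈⟨ ≋-trans (Q.Xⁿ-⊕ e′ _ _) (Q.⊕-cong (Q.Xⁿ-⊕ e′ _ _) ≋-refl) ⟩
    Xⁿ e′ (F K) ⊕ Xⁿ e′ (Xⁿ (suc K) (Xⁿ (suc K) (F (suc K)))) ⊕ Xⁿ e′ (Xⁿ (w₁ K) (F K))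
  ≈⟨ Q.⊕-cong (Q.⊕-cong (≡⇒≋ (Xⁿ-merge {e′} {0} {w₂ K} {e K} (F K) (trans (ℕ.+-identityʳ e′) e′≡)))
                         (≡⇒≋ (trans (cong (Xⁿ e′) (sym (Q.Xⁿ-+ (suc K) (suc K) _)))
                                     (Xⁿ-merge {e′} {w₂ K} {w₂ K} {e′} (F (suc K)) (ℕ.+-comm e′ (w₂ K))))))
              (≡⇒≋ (Xⁿ-merge {e′} {w₁ K} {w₃ K} {e K} (F K) e′+w₁≡)) ⟩
    Xⁿ (w₂ K) (Xⁿ (e K) (F K)) ⊕ Xⁿ (w₂ K) (Xⁿ e′ (F (suc K))) ⊕ Xⁿ (w₃ K) (Xⁿ (e K) (F K))
  ≈⟨ (λ N → solve 3 (λ a b c → a :+ b :+ c := a :+ c :+ b) refl (Xⁿ (w₂ K) (Xⁿ (e K) (F K)) N) _ _) ⟩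
    Xⁿ (w₂ K) (Xⁿ (e K) (F K)) ⊕ Xⁿ (w₃ K) (Xⁿ (e K) (F K)) ⊕ Xⁿ (w₂ K) (Xⁿ e′ (F (suc K)))
  ≈⟨ ≋-sym (Q.⊕-cong (Q.⊕-cong (Q.Xⁿ-cong (w₂ K) (sumA≋F K)) (Q.Xⁿ-cong (w₃ K) (sumA≋F K)))
                                (Q.Xⁿ-cong (w₂ K) (sumA≋F (suc K)))) ⟩
    Xⁿ (w₂ K) (sumA K) ⊕ Xⁿ (w₃ K) (sumA K) ⊕ Xⁿ (w₂ K) (sumA (suc K))
  ∎
  where
    open import Relation.Binary.Reasoning.Setoid (Q.≋-setoid)
    open +-*-Solver
    e′ = e (suc K)
    e′≡ : e′ ≡ w₂ K + e K
    e′≡ = solve 1 (λ k → (con 1 :+ k) :* (con 2 :+ k)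
                         := ((con 1 :+ k) :+ (con 1 :+ k)) :+ k :* (con 1 :+ k)) refl K
    e′+w₁≡ : e′ + w₁ K ≡ w₃ K + e K
    e′+w₁≡ = solve 1 (λ k → (con 1 :+ k) :* (con 2 :+ k) :+ (con 1 :+ (k :+ k))
                := ((con 1 :+ k) :+ (con 1 :+ k) :+ (con 1 :+ (k :+ k))) :+ k :* (con 1 :+ k)) refl K

sumA-0 : sumA 0 ≋ 𝟙
sumA-0 N = trans (ℕ.+-identityʳ _)
  (trans (Defs⊛≋⊛ one one N) (trans (Q.⊛-cong one≋𝟙 one≋𝟙 N) (Q.⊛-identityˡ 𝟙 N)))

-- The second double sum is  B_{k+1} = q^{2k+1} A_k  (and B₀ = 0), termwise,
-- since L(m,n) + 2m + 2n + 1 = L(m,n) + 2k + 1 when m + n = k.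
sumB-rec : ∀ K → sumB (suc K) ≋ Xⁿ (w₁ K) (sumA K)
sumB-rec K = begin
    sumB (suc K)
  ≈⟨ sum-shifts (λ m → L m (K ∸ m) + 2 * m + 2 * (K ∸ m) + 1) (λ m → term m (K ∸ m)) (λ i → i) (suc K) ⟩
    XQ.∑< (λ m → Xⁿ (L m (K ∸ m) + 2 * m + 2 * (K ∸ m) + 1) (term m (K ∸ m))) (suc K)
  ≈⟨ ∑-cong _ _ (suc K) summand ⟩
    XQ.∑< (λ m → Xⁿ (w₁ K) (Xⁿ (L m (K ∸ m)) (term m (K ∸ m)))) (suc K)
  ≈⟨ ≋-sym (Xⁿ-∑ (w₁ K) (λ m → Xⁿ (L m (K ∸ m)) (term m (K ∸ m))) (suc K)) ⟩
    Xⁿ (w₁ K) (XQ.∑< (λ m → Xⁿ (L m (K ∸ m)) (term m (K ∸ m))) (suc K))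
  ≈⟨ Q.Xⁿ-cong (w₁ K) (≋-sym (sum-shifts (λ m → L m (K ∸ m)) (λ m → term m (K ∸ m)) (λ i → i) (suc K))) ⟩
    Xⁿ (w₁ K) (sumA K)
  ∎
  where
    open import Relation.Binary.Reasoning.Setoid (Q.≋-setoid)
    exponent : ∀ l m n → l + 2 * m + 2 * n + 1 ≡ w₁ (m + n) + l
    exponent = solve 3 (λ l m n → l :+ con 2 :* m :+ con 2 :* n :+ con 1 := con 1 :+ ((m :+ n) :+ (m :+ n)) :+ l) refl
      where open +-*-Solver
    summand : ∀ m → m < suc K → Xⁿ (L m (K ∸ m) + 2 * m + 2 * (K ∸ m) + 1) (term m (K ∸ m)) ≋
                                 Xⁿ (w₁ K) (Xⁿ (L m (K ∸ m)) (term m (K ∸ m)))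
    summand m (s≤s m≤K) = ≡⇒≋
      (trans (cong (λ s → Xⁿ s (term m (K ∸ m)))
                   (trans (exponent (L m (K ∸ m)) m (K ∸ m)) (cong (λ k → w₁ k + L m (K ∸ m)) (ℕ.m+[n∸m]≡n m≤K))))
             (Q.Xⁿ-+ (w₁ K) (L m (K ∸ m)) _))

Counted : ℕ → ℕ → ℕ → List ℕ → Set
Counted i k N π = lG i π × length π ≡ k × sum π ≡ N

raise : List ℕ → List ℕ
raise = map (2 +_)

length-raise : ∀ ρ → length (raise ρ) ≡ length ρ
length-raise = length-map (2 +_)

sum-raise : ∀ ρ → sum (raise ρ) ≡ length ρ + length ρ + sum ρ
sum-raise []      = refl
sum-raise (x ∷ ρ) = trans (cong (2 + x +_) (sum-raise ρ))
  (solve 3 (λ x l s → con 2 :+ x :+ (l :+ l :+ s) := (con 1 :+ l) :+ (con 1 :+ l) :+ (x :+ s)) refl x (length ρ) (sum ρ))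
  where open +-*-Solver

chain-raise : ∀ {π} → Chain π → Chain (raise π)
chain-raise []              = []
chain-raise [ x ]           = [ 2 + x ]
chain-raise ((d , if-odd) ∷ c) = (s≤s (s≤s d) , λ o → s≤s (s≤s (if-odd o))) ∷ chain-raise c

chain-lower : ∀ π → Chain (raise π) → Chain π
chain-lower []          _ = []
chain-lower (x ∷ [])    _ = [ x ]
chain-lower (x ∷ y ∷ π) ((s≤s (s≤s d) , if-odd) ∷ c) =
  (d , λ o → ℕ.≤-pred (ℕ.≤-pred (if-odd o))) ∷ chain-lower (y ∷ π) c

all-raise : ∀ {b π} → All (b ≤_) π → All (2 + b ≤_) (raise π)
all-raise []       = []
all-raise (p ∷ ps) = s≤s (s≤s p) ∷ all-raise ps

all-weaken : ∀ {a b π} → a ≤ b → All (b ≤_) π → All (a ≤_) π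
all-weaken a≤b = All.map (ℕ.≤-trans a≤b)

lG₂⇒lG₁ : ∀ {k N π} → Counted 2 k N π → Counted 1 k N π
lG₂⇒lG₁ ((all2 , c) , len , sm) = (all-weaken (s≤s z≤n) all2 , c) , len , sm

lower : ∀ {b} π → All (2 + b ≤_) π → Σ (List ℕ) λ ρ → π ≡ raise ρ × All (b ≤_) ρ
lower []                 []                  = [] , refl , []
lower (suc (suc x) ∷ xs) (s≤s (s≤s p) ∷ ps) with lower xs ps
... | ρ , refl , qs = x ∷ ρ , refl , p ∷ qs

lower₂ : ∀ {π} → All (4 ≤_) π → Chain π → Σ (List ℕ) λ ρ → π ≡ raise ρ × lG 2 ρ
lower₂ {π} all4 c with lower π all4
... | ρ , refl , all2 = ρ , refl , all2 , chain-lower ρ c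

raise-lG₂ : ∀ {π} → lG 2 π → lG 2 (raise π)
raise-lG₂ (all2 , c) = all-weaken (s≤s (s≤s z≤n)) (all-raise all2) , chain-raise c

chain-tail : ∀ {x ρ} → Chain (x ∷ ρ) → Chain ρ
chain-tail [ x ]   = []
chain-tail (_ ∷ c) = c

chain-above : ∀ {x ρ} → Chain (x ∷ ρ) → All (2 + x ≤_) ρ
chain-above [ x ]          = []
chain-above ((d , _) ∷ c)  = d ∷ all-weaken (ℕ.≤-trans d (ℕ.m≤n+m _ 2)) (chain-above c)

gap-after-odd : ∀ {a y} → a % 2 ≡ 1 → Gap a y → 3 + a ≤ y
gap-after-odd {a} a-odd (d , if-odd) with ℕ.m≤n⇒m<n∨m≡n d
... | inj₁ 2+a<y = 2+a<y
... | inj₂ refl  = if-odd (trans (cong (_% 2) (ℕ.+-comm 2 a)) (trans ([m+n]%n≡m%n a 2) a-odd))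

chain-above-odd : ∀ {x ρ} → x % 2 ≡ 1 → Chain (x ∷ ρ) → All (3 + x ≤_) ρ
chain-above-odd x-odd [ x ]     = []
chain-above-odd x-odd (g ∷ c)   =
  gap-after-odd x-odd g ∷ all-weaken (ℕ.≤-trans (gap-after-odd x-odd g) (ℕ.m≤n+m _ 2)) (chain-above c)

prepend : ∀ {b} x ρ → All (b ≤_) ρ → Chain ρ → (∀ y → b ≤ y → Gap x (2 + y)) → Chain (x ∷ raise ρ)
prepend x []      _           _ gap = [ x ]
prepend x (y ∷ ρ) (b≤y ∷ _) c gap = gap y b≤y ∷ chain-raise c

gap-below : ∀ {x y} → x < y → Gap x (2 + y)
gap-below x<y = s≤s (s≤s (ℕ.<⇒≤ x<y)) , λ _ → s≤s (s≤s x<y)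

gap-after-2 : ∀ y → 2 ≤ y → Gap 2 (2 + y)
gap-after-2 (suc zero) (s≤s ())
gap-after-2 (suc (suc zero)) _ = ℕ.≤-refl , λ ()
gap-after-2 (suc (suc (suc y))) _ = gap-below (s≤s (s≤s (s≤s z≤n)))

sum-raise-k : ∀ {k} ρ → length ρ ≡ k → sum (raise ρ) ≡ k + k + sum ρ
sum-raise-k ρ refl = sum-raise ρ

put1 put2 put3 : List ℕ → List ℕ
put1 ρ = 1 ∷ raise ρ
put2 ρ = 2 ∷ raise ρ
put3 ρ = 3 ∷ raise (raise ρ)

data Peel₂ (k N : ℕ) : List ℕ → Set where
  smallest-2  : ∀ {M ρ} → Counted 2 k M ρ       → w₂ k + M ≡ N → Peel₂ k N (put2 ρ)
  smallest-3  : ∀ {M ρ} → Counted 2 k M ρ       → w₃ k + M ≡ N → Peel₂ k N (put3 ρ)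
  smallest-≥4 : ∀ {M ρ} → Counted 2 (suc k) M ρ → w₂ k + M ≡ N → Peel₂ k N (raise ρ)

data Peel₁ (k N : ℕ) : List ℕ → Set where
  smallest-1 : ∀ {M ρ} → Counted 2 k M ρ → w₁ k + M ≡ N → Peel₁ k N (put1 ρ)

unpeel₂ : ∀ {k N π} → Peel₂ k N π → Counted 2 (suc k) N π
unpeel₂ {k} (smallest-2 {M} {ρ} ((all2 , c) , refl , refl) refl) =
  (ℕ.≤-refl ∷ all-weaken (s≤s (s≤s z≤n)) (all-raise all2) , prepend 2 ρ all2 c gap-after-2) ,
  cong suc (length-raise ρ) ,
  trans (cong (2 +_) (sum-raise ρ))
        (solve 2 (λ k m → con 2 :+ (k :+ k :+ m) := (con 1 :+ k) :+ (con 1 :+ k) :+ m) refl k M)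
  where open +-*-Solver
unpeel₂ {k} (smallest-3 {M} {ρ} ((all2 , c) , refl , refl) refl) =
  (s≤s (s≤s z≤n) ∷ all-weaken (s≤s (s≤s z≤n)) (all-raise (all-raise all2)) ,
   prepend 3 (raise ρ) (all-raise all2) (chain-raise c) (λ y → gap-below)) ,
  cong suc (trans (length-raise (raise ρ)) (length-raise ρ)) ,
  trans (cong (3 +_) (trans (sum-raise-k (raise ρ) (length-raise ρ)) (cong (λ s → k + k + s) (sum-raise ρ))))
        (solve 2 (λ k m → con 3 :+ (k :+ k :+ (k :+ k :+ m))
                          := (con 1 :+ k) :+ (con 1 :+ k) :+ (con 1 :+ (k :+ k)) :+ m) refl k M)
  where open +-*-Solver
unpeel₂ (smallest-≥4 {ρ = ρ} (l , len , refl) refl) =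
  raise-lG₂ l , trans (length-raise ρ) len , sum-raise-k ρ len

unpeel₁ : ∀ {k N π} → Peel₁ k N π → Counted 1 (suc k) N π
unpeel₁ (smallest-1 {ρ = ρ} ((all2 , c) , refl , refl) refl) =
  (s≤s z≤n ∷ all-weaken (s≤s z≤n) (all-raise all2) , prepend 1 ρ all2 c (λ y → gap-below)) ,
  cong suc (length-raise ρ) ,
  cong suc (sum-raise ρ)

peel₂ : ∀ {k N π} → Counted 2 (suc k) N π → Peel₂ k N π
peel₂ {k} {N} {x ∷ ρ} ((2≤x ∷ _ , c) , len , sm) = by-smallest x ρ 2≤x c (ℕ.suc-injective len) sm
  where
    open +-*-Solver
    by-smallest : ∀ x ρ → 2 ≤ x → Chain (x ∷ ρ) → length ρ ≡ k → x + sum ρ ≡ N → Peel₂ k N (x ∷ ρ)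
    by-smallest 1 ρ (s≤s ()) c len sm
    -- the parts after a 2 are ≥ 4
    by-smallest 2 ρ _ c len sm with lower₂ (chain-above c) (chain-tail c)
    ... | ρ′ , refl , l = smallest-2 (l , len′ , refl)
      (trans (solve 2 (λ k m → (con 1 :+ k) :+ (con 1 :+ k) :+ m := con 2 :+ (k :+ k :+ m)) refl k (sum ρ′))
             (trans (cong (2 +_) (sym (sum-raise-k ρ′ len′))) sm))
      where len′ = trans (sym (length-raise ρ′)) len
    -- the parts after a 3 are ≥ 6, since 5 is odd
    by-smallest 3 ρ _ c len sm with lower ρ (chain-above-odd refl c)
    ... | ρ₁ , refl , 4≤ρ₁ with lower₂ 4≤ρ₁ (chain-lower ρ₁ (chain-tail c))
    ... | ρ′ , refl , l = smallest-3 (l , len′ , refl)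
      (trans (solve 2 (λ k m → (con 1 :+ k) :+ (con 1 :+ k) :+ (con 1 :+ (k :+ k)) :+ m
                               := con 3 :+ (k :+ k :+ (k :+ k :+ m))) refl k (sum ρ′))
             (trans (cong (3 +_) (sym (trans (sum-raise-k (raise ρ′) (trans (length-raise ρ′) len′))
                                             (cong (λ s → k + k + s) (sum-raise-k ρ′ len′)))))
                    sm))
      where len′ = trans (sym (trans (length-raise (raise ρ′)) (length-raise ρ′))) len
    by-smallest (suc (suc (suc (suc _)))) ρ _ c len sm
      with lower₂ (s≤s (s≤s (s≤s (s≤s z≤n))) ∷ all-weaken (ℕ.m≤m+n 4 _) (chain-above c)) c
    ... | ρ′ , eq , l = subst (Peel₂ k N) (sym eq) (smallest-≥4 (l , len′ , refl)
      (trans (cong (λ s → s + s + sum ρ′) (sym len′))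
             (trans (sym (sum-raise ρ′)) (trans (cong sum (sym eq)) sm))))
      where len′ = trans (sym (length-raise ρ′)) (trans (cong length (sym eq)) (cong suc len))

-- Every partition in ℓG₁ with k+1 parts either has smallest part 1 or lies in ℓG₂;
-- the parts after a 1 are ≥ 4, since 3 is odd.
peel₁ : ∀ {k N π} → Counted 1 (suc k) N π → Peel₁ k N π ⊎ Counted 2 (suc k) N π
peel₁ {k} {N} {suc zero ∷ ρ} ((_ ∷ _ , c) , len , sm) with lower₂ (chain-above-odd refl c) (chain-tail c)
... | ρ′ , refl , l = inj₁ (smallest-1 (l , len′ , refl)
        (trans (cong suc (trans (cong (λ s → s + s + sum ρ′) (sym len′)) (sym (sum-raise ρ′)))) sm))
  where len′ = trans (sym (length-raise ρ′)) (ℕ.suc-injective len)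
peel₁ {π = suc (suc _) ∷ ρ} ((_ ∷ _ , c) , len , sm) =
  inj₂ ((s≤s (s≤s z≤n) ∷ all-weaken (ℕ.m≤m+n 2 _) (chain-above c) , c) , len , sm)

shiftL : ℕ → (ℕ → List (List ℕ)) → ℕ → List (List ℕ)
shiftL s g N = if s ≤ᵇ N then g (N ∸ s) else []

block : ℕ → (List ℕ → List ℕ) → (ℕ → List (List ℕ)) → ℕ → List (List ℕ)
block s h g = shiftL s (map h ∘ g)

length-block : ∀ s h g N → length (block s h g N) ≡ Xⁿ s (length ∘ g) N
length-block s h g N = trans (length-if (s ≤ᵇ N)) (shift≡Xⁿ s (length ∘ g) N)
  where
    length-if : ∀ b → length (if b then map h (g (N ∸ s)) else []) ≡ (if b then length (g (N ∸ s)) else 0)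
    length-if true  = length-map h (g (N ∸ s))
    length-if false = refl

∈-block⁻ : ∀ s h g N {π} → π ∈ block s h g N → Σ ℕ λ M → Σ (List ℕ) λ ρ → s + M ≡ N × ρ ∈ g M × π ≡ h ρ
∈-block⁻ s h g N m with s ≤ᵇ N in s≤ᵇN
... | true with ∈-map⁻ h m
... | ρ , mρ , π≡hρ =
  N ∸ s , ρ , ℕ.m+[n∸m]≡n (ℕ.≤ᵇ⇒≤ s N (subst Bool.T (sym s≤ᵇN) tt)) , mρ , π≡hρ

∈-block⁺ : ∀ s h g {M ρ} → ρ ∈ g M → h ρ ∈ block s h g (s + M)
∈-block⁺ s h g {M} mρ with s ≤ᵇ (s + M) | ℕ.≤⇒≤ᵇ (ℕ.m≤m+n s M)
... | true | _ = ∈-map⁺ h (subst (λ n → _ ∈ g n) (sym (ℕ.m+n∸m≡n s M)) mρ)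

unique-block : ∀ s h g N → (∀ {x y} → h x ≡ h y → x ≡ y) → Unique (g (N ∸ s)) → Unique (block s h g N)
unique-block s h g N h-inj u with s ≤ᵇ N
... | true  = UP.map⁺ h-inj u
... | false = []

raise-injective : ∀ {ρ ρ′} → raise ρ ≡ raise ρ′ → ρ ≡ ρ′
raise-injective = map-injective (ℕ.+-cancelˡ-≡ 2 _ _)

put-injective : ∀ {x ρ ρ′} → x ∷ raise ρ ≡ x ∷ raise ρ′ → ρ ≡ ρ′
put-injective = raise-injective ∘ proj₂ ∘ ∷-injective

-- The fuel bounds the
-- recursion depth; it is sufficient as soon as N ≤ fuel.
enum₂ : ℕ → ℕ → ℕ → List (List ℕ)
enum₂ fuel       zero    zero    = [] ∷ []
enum₂ fuel       zero    (suc N) = []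
enum₂ zero       (suc k) N       = []
enum₂ (suc fuel) (suc k) N       =
  block (w₂ k) put2 (enum₂ fuel k) N ++
  (block (w₃ k) put3 (enum₂ fuel k) N ++
   block (w₂ k) raise (enum₂ fuel (suc k)) N)

enum₁ : ℕ → ℕ → ℕ → List (List ℕ)
enum₁ fuel zero    N = enum₂ fuel zero N
enum₁ fuel (suc k) N = block (w₁ k) put1 (enum₂ fuel k) N ++ enum₂ fuel (suc k) N

Xⁿ-agree : ∀ s f N {g h : ℕ → ℕ} → 0 < s → (∀ M → M ≤ f → g M ≡ h M) → N ≤ suc f → Xⁿ s g N ≡ Xⁿ s h N
Xⁿ-agree (suc s)       f zero    _ agree _         = refl
Xⁿ-agree (suc zero)    f (suc N) _ agree (s≤s N≤f) = agree N N≤f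
Xⁿ-agree (suc (suc s)) f (suc N) _ agree (s≤s N≤f) = Xⁿ-agree (suc s) f N (s≤s z≤n) agree (ℕ.m≤n⇒m≤1+n N≤f)

length-block-≡ : ∀ s h g f N (c : ℕ → ℕ) → 0 < s → (∀ M → M ≤ f → length (g M) ≡ c M) → N ≤ suc f →
                 length (block s h g N) ≡ Xⁿ s c N
length-block-≡ s h g f N c 0<s counts N≤ = trans (length-block s h g N) (Xⁿ-agree s f N 0<s counts N≤)

count₂ : ∀ fuel k N → N ≤ fuel → length (enum₂ fuel k N) ≡ sumA k N
count₂ f       zero    zero    _   = sym (sumA-0 0)
count₂ f       zero    (suc N) _   = sym (sumA-0 (suc N))
count₂ zero    (suc k) zero    _   = sym (sumA-rec k 0)
count₂ (suc f) (suc k) N       N≤f = begin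
    length (B₂ ++ (B₃ ++ B₄))
  ≡⟨ trans (length-++ B₂) (cong (length B₂ +_) (length-++ B₃)) ⟩
    length B₂ + (length B₃ + length B₄)
  ≡⟨ cong₂ _+_ (counted (w₂ k) put2 k (s≤s z≤n))
               (cong₂ _+_ (counted (w₃ k) put3 k (s≤s z≤n)) (counted (w₂ k) raise (suc k) (s≤s z≤n))) ⟩
    Xⁿ (w₂ k) (sumA k) N + (Xⁿ (w₃ k) (sumA k) N + Xⁿ (w₂ k) (sumA (suc k)) N)
  ≡⟨ sym (trans (sumA-rec k N) (ℕ.+-assoc (Xⁿ (w₂ k) (sumA k) N) _ _)) ⟩
    sumA (suc k) N
  ∎
  where
    open ≡-Reasoning
    B₂ = block (w₂ k) put2 (enum₂ f k) N
    B₃ = block (w₃ k) put3 (enum₂ f k) N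
    B₄ = block (w₂ k) raise (enum₂ f (suc k)) N
    counted : ∀ s h k′ → 0 < s → length (block s h (enum₂ f k′) N) ≡ Xⁿ s (sumA k′) N
    counted s h k′ 0<s = length-block-≡ s h (enum₂ f k′) f N (sumA k′) 0<s (count₂ f k′) N≤f

count₁ : ∀ fuel k N → N ≤ fuel → length (enum₁ fuel k N) ≡ sumA k N + sumB k N
count₁ f zero    N N≤f = trans (count₂ f zero N N≤f) (sym (ℕ.+-identityʳ _))
count₁ f (suc k) N N≤f = begin
    length (B₁ ++ enum₂ f (suc k) N)
  ≡⟨ length-++ B₁ ⟩
    length B₁ + length (enum₂ f (suc k) N)
  ≡⟨ cong₂ _+_ (length-block-≡ (w₁ k) put1 (enum₂ f k) f N (sumA k) (s≤s z≤n) (count₂ f k) (ℕ.m≤n⇒m≤1+n N≤f))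
               (count₂ f (suc k) N N≤f) ⟩
    Xⁿ (w₁ k) (sumA k) N + sumA (suc k) N
  ≡⟨ cong (_+ sumA (suc k) N) (sym (sumB-rec k N)) ⟩
    sumB (suc k) N + sumA (suc k) N
  ≡⟨ ℕ.+-comm (sumB (suc k) N) _ ⟩
    sumA (suc k) N + sumB (suc k) N
  ∎
  where
    open ≡-Reasoning
    B₁ = block (w₁ k) put1 (enum₂ f k) N

sound₂ : ∀ fuel k N {π} → π ∈ enum₂ fuel k N → Counted 2 k N π
sound₂ f       zero    zero (here refl) = ([] , []) , refl , refl
sound₂ (suc f) (suc k) N    m with ∈-++⁻ (block (w₂ k) put2 (enum₂ f k) N) m
... | inj₁ m₂ with ∈-block⁻ (w₂ k) put2 (enum₂ f k) N m₂
...   | M , ρ , eq , mρ , refl = unpeel₂ (smallest-2 (sound₂ f k M mρ) eq)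
sound₂ (suc f) (suc k) N    m | inj₂ m′ with ∈-++⁻ (block (w₃ k) put3 (enum₂ f k) N) m′
... | inj₁ m₃ with ∈-block⁻ (w₃ k) put3 (enum₂ f k) N m₃
...   | M , ρ , eq , mρ , refl = unpeel₂ (smallest-3 (sound₂ f k M mρ) eq)
sound₂ (suc f) (suc k) N    m | inj₂ m′ | inj₂ m₄ with ∈-block⁻ (w₂ k) raise (enum₂ f (suc k)) N m₄
...   | M , ρ , eq , mρ , refl = unpeel₂ (smallest-≥4 (sound₂ f (suc k) M mρ) eq)

sound₁ : ∀ fuel k N {π} → π ∈ enum₁ fuel k N → Counted 1 k N π
sound₁ f zero    N m = lG₂⇒lG₁ (sound₂ f zero N m)
sound₁ f (suc k) N m with ∈-++⁻ (block (w₁ k) put1 (enum₂ f k) N) m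
... | inj₂ m₂ = lG₂⇒lG₁ (sound₂ f (suc k) N m₂)
... | inj₁ m₁ with ∈-block⁻ (w₁ k) put1 (enum₂ f k) N m₁
...   | M , ρ , eq , mρ , refl = unpeel₁ (smallest-1 (sound₂ f k M mρ) eq)

fuel-drop : ∀ {w M N f} → suc w + M ≡ N → N ≤ suc f → M ≤ f
fuel-drop {w} refl (s≤s w+M≤f) = ℕ.≤-trans (ℕ.m≤n+m _ w) w+M≤f

complete₂ : ∀ fuel k N {π} → N ≤ fuel → Counted 2 k N π → π ∈ enum₂ fuel k N
complete₂ f       zero    N {[]}    _   (_ , refl , refl) = here refl
complete₂ zero    (suc k) N {x ∷ ρ} N≤0 ((2≤x ∷ _ , _) , _ , refl)
  with () ← ℕ.≤-trans 2≤x (ℕ.≤-trans (ℕ.m≤m+n x (sum ρ)) N≤0)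
complete₂ (suc f) (suc k) N     N≤f c with peel₂ c
... | smallest-2 {M} l refl = ∈-++⁺ˡ (∈-block⁺ (w₂ k) put2 (enum₂ f k) (complete₂ f k M (fuel-drop refl N≤f) l))
... | smallest-3 {M} l refl = ∈-++⁺ʳ (block (w₂ k) put2 (enum₂ f k) N)
        (∈-++⁺ˡ (∈-block⁺ (w₃ k) put3 (enum₂ f k) (complete₂ f k M (fuel-drop refl N≤f) l)))
... | smallest-≥4 {M} l refl =
  ∈-++⁺ʳ (block (w₂ k) put2 (enum₂ f k) N) (∈-++⁺ʳ (block (w₃ k) put3 (enum₂ f k) N)
        (∈-block⁺ (w₂ k) raise (enum₂ f (suc k)) (complete₂ f (suc k) M (fuel-drop refl N≤f) l)))

complete₁ : ∀ fuel k N {π} → N ≤ fuel → Counted 1 k N π → π ∈ enum₁ fuel k N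
complete₁ f zero    N {[]} _ (_ , refl , refl) = complete₂ f zero N z≤n (([] , []) , refl , refl)
complete₁ f (suc k) N N≤f c with peel₁ c
... | inj₁ (smallest-1 {M} l refl) =
  ∈-++⁺ˡ (∈-block⁺ (w₁ k) put1 (enum₂ f k) (complete₂ f k M (ℕ.≤-trans (ℕ.m≤n+m M _) N≤f) l))
... | inj₂ c₂ = ∈-++⁺ʳ (block (w₁ k) put1 (enum₂ f k) N) (complete₂ f (suc k) N N≤f c₂)

smallest : List ℕ → ℕ
smallest []      = 0
smallest (x ∷ _) = x

apart : ∀ a {xs ys : List (List ℕ)} → (∀ {π} → π ∈ xs → smallest π ≡ a) →
        (∀ {π} → π ∈ ys → a < smallest π) → Disjoint xs ys
apart a in-xs in-ys (mx , my) = ℕ.<-irrefl (sym (in-xs mx)) (in-ys my)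

block-smallest : ∀ s x (f : List ℕ → List ℕ) g N {π} → π ∈ block s (λ ρ → x ∷ f ρ) g N → smallest π ≡ x
block-smallest s x f g N m with ∈-block⁻ s (λ ρ → x ∷ f ρ) g N m
... | _ , _ , _ , _ , π≡xfρ = cong smallest π≡xfρ

raise-smallest : ∀ ρ → 2 ≤ smallest ρ → 4 ≤ smallest (raise ρ)
raise-smallest (x ∷ ρ) 2≤x = s≤s (s≤s 2≤x)

enum₂-smallest : ∀ fuel k N {π} → π ∈ enum₂ fuel (suc k) N → 2 ≤ smallest π
enum₂-smallest f k N m with sound₂ f (suc k) N m
... | (2≤x ∷ _ , _) , _ = 2≤x

-- No partition is listed twice: the blocks are images of duplicate-free lists under
-- injective maps, and have different smallest parts.
unique₂ : ∀ fuel k N → Unique (enum₂ fuel k N)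
unique₂ f       zero    zero    = [] ∷ []
unique₂ f       zero    (suc N) = []
unique₂ zero    (suc k) N       = []
unique₂ (suc f) (suc k) N       =
  UP.++⁺ (unique-block (w₂ k) put2 (enum₂ f k) N put-injective (unique₂ f k _))
    (UP.++⁺ (unique-block (w₃ k) put3 (enum₂ f k) N (raise-injective ∘ put-injective) (unique₂ f k _))
            (unique-block (w₂ k) raise (enum₂ f (suc k)) N raise-injective (unique₂ f (suc k) _))
            (apart 3 (block-smallest (w₃ k) 3 (raise ∘ raise) (enum₂ f k) N) above-3))
    (apart 2 (block-smallest (w₂ k) 2 raise (enum₂ f k) N) above-2)
  where
    above-3 : ∀ {π} → π ∈ block (w₂ k) raise (enum₂ f (suc k)) N → 3 < smallest π
    above-3 m with ∈-block⁻ (w₂ k) raise (enum₂ f (suc k)) N m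
    ... | M , ρ , _ , mρ , refl = raise-smallest ρ (enum₂-smallest f k M mρ)
    above-2 : ∀ {π} → π ∈ block (w₃ k) put3 (enum₂ f k) N ++ block (w₂ k) raise (enum₂ f (suc k)) N →
              2 < smallest π
    above-2 m with ∈-++⁻ (block (w₃ k) put3 (enum₂ f k) N) m
    ... | inj₁ m₃ = subst (2 <_) (sym (block-smallest (w₃ k) 3 (raise ∘ raise) (enum₂ f k) N m₃)) ℕ.≤-refl
    ... | inj₂ m₄ = ℕ.<-trans (s≤s (s≤s (s≤s z≤n))) (above-3 m₄)

unique₁ : ∀ fuel k N → Unique (enum₁ fuel k N)
unique₁ f zero    N = unique₂ f zero N
unique₁ f (suc k) N =
  UP.++⁺ (unique-block (w₁ k) put1 (enum₂ f k) N put-injective (unique₂ f k _)) (unique₂ f (suc k) N)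
    (apart 1 (block-smallest (w₁ k) 1 raise (enum₂ f k) N) (enum₂-smallest f k N))

theorem4p2 : (k N : ℕ) → EnumCount 1 k N (sumA k N + sumB k N) × EnumCount 2 k N (sumA k N)
theorem4p2 k N =
  (enum₁ N k N , unique₁ N k N , (λ π → sound₁ N k N , complete₁ N k N ℕ.≤-refl) , count₁ N k N ℕ.≤-refl) ,
  (enum₂ N k N , unique₂ N k N , (λ π → sound₂ N k N , complete₂ N k N ℕ.≤-refl) , count₂ N k N ℕ.≤-refl)
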